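{- Let $X=\{a_1,\dots,a_n\}$, let $\mathcal{F}$ be a union-closed family of subsets of $X$ with $\bigcup_{f\in\mathcal{F}}f=X$, let $w=a_1\cdots a_n$ and $\mathcal{U}=\varphi_w(\mathcal{F})$. For each $S\subseteq\mathcal{F}$, $\varphi_w$ restricts to a bijection $\varphi_w:\mathcal{F}[S]\to\mathcal{U}[S]$, where $\mathcal{F}[S]=\{g\in\mathcal{F}:\exists z\in S,\ z\subseteq g\}$ and $\mathcal{U}[S]=\{\eta\in\mathcal{U}:\exists z\in S,\ z\subseteq \eta\}$. Moreover, the inverse of $\varphi_w:\mathcal{F}\to\mathcal{U}$ is given, for every $\eta\in\mathcal{U}$, by $$\varphi_w^{ -1}(\eta)=\bigcup_{\{f\in\mathcal{F}:\ f\subseteq\eta\}}f.$$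
   Context: Union-closed: $f,g\in\mathcal{F}\Rightarrow f\cup g\in\mathcal{F}$. Rising functions: for $T\subseteq 2^X$ and $a\in X$, $\varphi_{T,a}(z)=z\cup\{a\}$ if $z\cup\{a\}\notin T$, and $\varphi_{T,a}(z)=z$ otherwise. With $\varphi_0=\mathrm{id}$, $\mathcal{F}_0=\mathcal{F}$, and $\varphi_j=\varphi_{\mathcal{F}_{j-1},a_j}\circ\varphi_{j-1}$, $\mathcal{F}_j=\varphi_j(\mathcal{F})$ for $1\le j\le n$, set $\varphi_w=\varphi_n$; it is injective on $\mathcal{F}$. -}

module Defs where

open import Data.Nat using (ℕ)
open import Data.Bool using (Bool) renaming (_≟_ to _≟ᴮ_)
open import Data.Fin using (Fin)
open import Data.Fin.Subset using (Subset; _∪_; ⁅_⁆; _⊆_; ⋃; ⊤)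
open import Data.Fin.Subset.Properties using (_⊆?_)
open import Data.Vec.Properties using (≡-dec)
open import Data.List using (List; []; _∷_; map; filter; reverse)
open import Data.List.Membership.Propositional using (_∈_)
open import Data.Product using (Σ; _×_; ∃)
open import Relation.Binary.PropositionalEquality using (_≡_)
open import Relation.Binary.Definitions using (DecidableEquality)
open import Relation.Nullary using (yes; no)
import Data.List.Membership.DecPropositional as DecMem

Family : ℕ → Set
Family n = List (Subset n)

_≟ˢ_ : {n : ℕ} → DecidableEquality (Subset n)
_≟ˢ_ = ≡-dec _≟ᴮ_

module _ {n : ℕ} where
  open DecMem (_≟ˢ_ {n}) using (_∈?_)

  UnionClosed : Family n → Set
  UnionClosed F = ∀ f g → f ∈ F → g ∈ F → (f ∪ g) ∈ F

  rise : Family n → Fin n → Subset n → Subset n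
  rise T a z with (z ∪ ⁅ a ⁆) ∈? T
  ... | yes _ = z
  ... | no  _ = z ∪ ⁅ a ⁆

  -- φ for a word given in REVERSED order (last letter first):
  -- φ_{w a} = φ_{F_w , a} ∘ φ_w  where F_w = φ_w(F); φ_[] = id.
  phiRev : Family n → List (Fin n) → Subset n → Subset n
  phiRev F []       z = z
  phiRev F (a ∷ rs) z = rise (map (phiRev F rs) F) a (phiRev F rs z)

  phiW : Family n → List (Fin n) → Subset n → Subset n
  phiW F w = phiRev F (reverse w)

  _∈[_][_] : Subset n → Family n → Family n → Set
  g ∈[ G ][ S ] = g ∈ G × Σ (Subset n) (λ z → z ∈ S × z ⊆ g)

  unionBelow : Family n → Subset n → Subset n
  unionBelow F η = ⋃ (filter (_⊆? η) F)

module Submission where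

-- Write φ_rs for the composite rising function of a reversed
-- word rs (so φ_w = φ_(reverse w)) and F_rs = φ_rs(F) for its stage.  Every
-- rising function only adds elements, so φ_rs is extensive: f ⊆ φ_rs(f).
-- The heart of the argument is a pair of lemmas valid for EVERY word:
--   (absorption)  φ_rs(f) ∪ g ∈ F_rs          for all f, g ∈ F;
--   (no capture)  g ⊆ φ_rs(f) implies g ⊆ f  for all f, g ∈ F.
-- Absorption is proved by induction on the word from union-closedness of
-- F = F_[]; no capture follows from it, since an added letter a with a ∈ g
-- would give φ(f) ∪ {a} = φ(f) ∪ g ∈ F_rs, so a would not have been added.
-- From these: φ_rs(f) ⊆ φ_rs(g) forces f ⊆ g, hence φ_rs is injective on F;
-- the members of F below φ_rs(f) are exactly those below f, so their union
-- is f, which is the inverse formula; and for z ∈ S ⊆ F, z ⊆ φ_rs(f) iff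
-- z ⊆ f, which makes φ_rs a bijection F[S] → U[S].

open import Defs
open import Data.Nat using (ℕ)
open import Data.Fin using (Fin)
open import Data.Fin.Subset using (Subset; ⋃; ⊤; _∪_; ⁅_⁆; _⊆_)
import Data.Fin.Subset as Sub
open import Data.Fin.Subset.Properties
  using (⊆-trans; ⊆-antisym; p⊆p∪q; q⊆p∪q; x∈p∪q⁻; x∈⁅y⁆⇒x≡y; ∉⊥; _⊆?_; ∪-assoc; ∪-comm; ∪-idem)
import Data.Fin.Subset.Properties as SubProp
open import Data.List using (List; []; _∷_; map; filter; reverse; allFin)
open import Data.List.Properties using (map-id; map-∘)
open import Data.List.Membership.Propositional using (_∈_)
open import Data.List.Membership.Propositional.Properties using (∈-map⁺; ∈-map⁻; ∈-filter⁺; ∈-filter⁻)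
open import Data.List.Relation.Unary.Any using (here; there)
open import Data.List.Relation.Unary.All using (All; []; _∷_; lookup; tabulate)
open import Data.List.Relation.Binary.Permutation.Propositional using (_↭_)
open import Data.Product using (Σ; _×_; _,_)
open import Data.Sum using (_⊎_; inj₁; inj₂)
open import Data.Empty using (⊥-elim)
open import Relation.Nullary using (¬_; yes; no)
open import Relation.Binary.PropositionalEquality using (_≡_; refl; sym; trans; cong; subst; module ≡-Reasoning)
import Data.List.Membership.DecPropositional as DecMem

module _ {n : ℕ} where
  open DecMem (_≟ˢ_ {n}) using (_∈?_)

  ∪-lub : {z g h : Subset n} → z ⊆ h → g ⊆ h → z ∪ g ⊆ h
  ∪-lub {z} {g} z⊆h g⊆h x∈z∪g with x∈p∪q⁻ z g x∈z∪g
  ... | inj₁ x∈z = z⊆h x∈z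
  ... | inj₂ x∈g = g⊆h x∈g

  ∪-swap : (z g : Subset n) (a : Fin n) → (z ∪ ⁅ a ⁆) ∪ g ≡ (z ∪ g) ∪ ⁅ a ⁆
  ∪-swap z g a = begin
    (z ∪ ⁅ a ⁆) ∪ g   ≡⟨ ∪-assoc z ⁅ a ⁆ g ⟩
    z ∪ (⁅ a ⁆ ∪ g)   ≡⟨ cong (z ∪_) (∪-comm ⁅ a ⁆ g) ⟩
    z ∪ (g ∪ ⁅ a ⁆)   ≡⟨ sym (∪-assoc z g ⁅ a ⁆) ⟩
    (z ∪ g) ∪ ⁅ a ⁆   ∎
    where open ≡-Reasoning

  ∪-⁅⁆-idem : (y : Subset n) (a : Fin n) → (y ∪ ⁅ a ⁆) ∪ ⁅ a ⁆ ≡ y ∪ ⁅ a ⁆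
  ∪-⁅⁆-idem y a = trans (∪-assoc y ⁅ a ⁆ ⁅ a ⁆) (cong (y ∪_) (∪-idem ⁅ a ⁆))

  ∪-absorb : (z g : Subset n) (a : Fin n) → g ⊆ z ∪ ⁅ a ⁆ → a Sub.∈ g → z ∪ g ≡ z ∪ ⁅ a ⁆
  ∪-absorb z g a g⊆za a∈g = ⊆-antisym (∪-lub (p⊆p∪q ⁅ a ⁆) g⊆za) (∪-lub (p⊆p∪q g) ⁅a⁆⊆z∪g)
    where
    ⁅a⁆⊆z∪g : ⁅ a ⁆ ⊆ z ∪ g
    ⁅a⁆⊆z∪g x∈⁅a⁆ = q⊆p∪q z g (subst (Sub._∈ g) (sym (x∈⁅y⁆⇒x≡y a x∈⁅a⁆)) a∈g)

  ⊆-drop : (z g : Subset n) (a : Fin n) → g ⊆ z ∪ ⁅ a ⁆ → ¬ (a Sub.∈ g) → g ⊆ z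
  ⊆-drop z g a g⊆za a∉g {x} x∈g with x∈p∪q⁻ z ⁅ a ⁆ (g⊆za x∈g)
  ... | inj₁ x∈z = x∈z
  ... | inj₂ x∈⁅a⁆ = ⊥-elim (a∉g (subst (Sub._∈ g) (x∈⁅y⁆⇒x≡y a x∈⁅a⁆) x∈g))

  ⋃-upper : (L : List (Subset n)) {f : Subset n} → f ∈ L → f ⊆ ⋃ L
  ⋃-upper (g ∷ L) (here refl) = p⊆p∪q (⋃ L)
  ⋃-upper (g ∷ L) (there f∈L) = ⊆-trans (⋃-upper L f∈L) (q⊆p∪q g (⋃ L))

  ⋃-least : (L : List (Subset n)) {f : Subset n} → All (_⊆ f) L → ⋃ L ⊆ f
  ⋃-least []      []           x∈⊥ = ⊥-elim (∉⊥ x∈⊥)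
  ⋃-least (g ∷ L) (g⊆f ∷ L⊆f)     = ∪-lub g⊆f (⋃-least L L⊆f)

  rise-cases : (T : Family n) (a : Fin n) (z : Subset n) →
    ((z ∪ ⁅ a ⁆) ∈ T × rise T a z ≡ z) ⊎ (¬ ((z ∪ ⁅ a ⁆) ∈ T) × rise T a z ≡ z ∪ ⁅ a ⁆)
  rise-cases T a z with (z ∪ ⁅ a ⁆) ∈? T
  ... | yes za∈T = inj₁ (za∈T , refl)
  ... | no  za∉T = inj₂ (za∉T , refl)

  rise-extensive : (T : Family n) (a : Fin n) (z : Subset n) → z ⊆ rise T a z
  rise-extensive T a z with rise-cases T a z
  ... | inj₁ (_ , fixed) = subst (z ⊆_) (sym fixed) (λ x∈z → x∈z)
  ... | inj₂ (_ , added) = subst (z ⊆_) (sym added) (p⊆p∪q ⁅ a ⁆)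

  -- If y ∈ T then y ∪ {a} lies in φ_{T,a}(T): either y itself rises to it,
  -- or it already belongs to T and, being saturated in a, stays fixed.
  rise-saturates : (T : Family n) (a : Fin n) (y : Subset n) → y ∈ T → (y ∪ ⁅ a ⁆) ∈ map (rise T a) T
  rise-saturates T a y y∈T with rise-cases T a y
  ... | inj₂ (_ , added) = subst (_∈ map (rise T a) T) added (∈-map⁺ (rise T a) y∈T)
  ... | inj₁ (ya∈T , _) with rise-cases T a (y ∪ ⁅ a ⁆)
  ...   | inj₁ (_ , fixed) = subst (_∈ map (rise T a) T) fixed (∈-map⁺ (rise T a) ya∈T)
  ...   | inj₂ (yaa∉T , _) = ⊥-elim (yaa∉T (subst (_∈ T) (sym (∪-⁅⁆-idem y a)) ya∈T))

  Stage : Family n → List (Fin n) → Family n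
  Stage F rs = map (phiRev F rs) F

  stage-step : (F : Family n) (a : Fin n) (rs : List (Fin n)) {y : Subset n} →
    y ∈ map (rise (Stage F rs) a) (Stage F rs) → y ∈ Stage F (a ∷ rs)
  stage-step F a rs = subst (_ ∈_) (sym (map-∘ F))

  phi-extensive : (F : Family n) (rs : List (Fin n)) (z : Subset n) → z ⊆ phiRev F rs z
  phi-extensive F []       z x∈z = x∈z
  phi-extensive F (a ∷ rs) z     = ⊆-trans (phi-extensive F rs z) (rise-extensive (Stage F rs) a (phiRev F rs z))

  module _ (F : Family n) (closed : UnionClosed F) where

    -- With
    -- y = φ_rs(f): if a was added to y, (y ∪ {a}) ∪ g = (y ∪ g) ∪ {a} is in
    -- the next stage by rise-saturates; if y was blocked, so is y ∪ g.
    absorption : (rs : List (Fin n)) {f g : Subset n} → f ∈ F → g ∈ F → (phiRev F rs f ∪ g) ∈ Stage F rs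
    absorption [] {f} {g} f∈F g∈F = subst ((f ∪ g) ∈_) (sym (map-id F)) (closed f g f∈F g∈F)
    absorption (a ∷ rs) {f} {g} f∈F g∈F with rise-cases (Stage F rs) a (phiRev F rs f)
    ... | inj₂ (_ , added) = subst (λ u → (u ∪ g) ∈ Stage F (a ∷ rs)) (sym added)
          (subst (_∈ Stage F (a ∷ rs)) (sym (∪-swap y g a))
            (stage-step F a rs (rise-saturates (Stage F rs) a (y ∪ g) (absorption rs f∈F g∈F))))
      where
      y : Subset n
      y = phiRev F rs f
    ... | inj₁ (ya∈T , fixed) with ∈-map⁻ (phiRev F rs) ya∈T
    ...   | f′ , f′∈F , ya≡φf′ = subst (λ u → (u ∪ g) ∈ Stage F (a ∷ rs)) (sym fixed)
          (subst (_∈ Stage F (a ∷ rs)) yg-fixed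
            (stage-step F a rs (∈-map⁺ (rise (Stage F rs) a) (absorption rs f∈F g∈F))))
      where
      y : Subset n
      y = phiRev F rs f
      -- (y ∪ g) ∪ {a} = φ_rs(f′) ∪ g is already in F_rs, so y ∪ g does not rise.
      yga∈T : ((y ∪ g) ∪ ⁅ a ⁆) ∈ Stage F rs
      yga∈T = subst (_∈ Stage F rs) (trans (cong (_∪ g) (sym ya≡φf′)) (∪-swap y g a)) (absorption rs f′∈F g∈F)
      yg-fixed : rise (Stage F rs) a (y ∪ g) ≡ y ∪ g
      yg-fixed with rise-cases (Stage F rs) a (y ∪ g)
      ... | inj₁ (_ , fixed′) = fixed′
      ... | inj₂ (yga∉T , _)  = ⊥-elim (yga∉T yga∈T)

    no-capture : (rs : List (Fin n)) {f g : Subset n} → f ∈ F → g ∈ F → g ⊆ phiRev F rs f → g ⊆ f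
    no-capture [] f∈F g∈F g⊆f = g⊆f
    no-capture (a ∷ rs) {f} {g} f∈F g∈F g⊆φf with rise-cases (Stage F rs) a (phiRev F rs f)
    ... | inj₁ (_ , fixed) = no-capture rs f∈F g∈F (subst (g ⊆_) fixed g⊆φf)
    ... | inj₂ (ya∉T , added) with a SubProp.∈? g
    ...   | no  a∉g = no-capture rs f∈F g∈F (⊆-drop (phiRev F rs f) g a (subst (g ⊆_) added g⊆φf) a∉g)
    ...   | yes a∈g = ⊥-elim (ya∉T (subst (_∈ Stage F rs)
              (∪-absorb (phiRev F rs f) g a (subst (g ⊆_) added g⊆φf) a∈g) (absorption rs f∈F g∈F)))

    phi-injective : (rs : List (Fin n)) {f g : Subset n} → f ∈ F → g ∈ F → phiRev F rs f ≡ phiRev F rs g → f ≡ g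
    phi-injective rs {f} {g} f∈F g∈F φf≡φg = ⊆-antisym
      (no-capture rs g∈F f∈F (subst (f ⊆_) φf≡φg (phi-extensive F rs f)))
      (no-capture rs f∈F g∈F (subst (g ⊆_) (sym φf≡φg) (phi-extensive F rs g)))

    unionBelow-inverse : (rs : List (Fin n)) {f : Subset n} → f ∈ F → unionBelow F (phiRev F rs f) ≡ f
    unionBelow-inverse rs {f} f∈F = ⊆-antisym
      (⋃-least below (tabulate below⊆f))
      (⋃-upper below (∈-filter⁺ (_⊆? φf) f∈F (phi-extensive F rs f)))
      where
      φf : Subset n
      φf = phiRev F rs f
      below : List (Subset n)
      below = filter (_⊆? φf) F
      below⊆f : {g : Subset n} → g ∈ below → g ⊆ f
      below⊆f g∈below with ∈-filter⁻ (_⊆? φf) {xs = F} g∈below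
      ... | g∈F , g⊆φf = no-capture rs f∈F g∈F g⊆φf

corollary3p5 : (n : ℕ) (F : Family n) (w : List (Fin n)) →
    w ↭ allFin n →
    UnionClosed F →
    ⋃ F ≡ ⊤ →
    ((S : Family n) → All (_∈ F) S →
      ((g : Subset n) → g ∈[ F ][ S ] → phiW F w g ∈[ map (phiW F w) F ][ S ])
      × ((g h : Subset n) → g ∈[ F ][ S ] → h ∈[ F ][ S ] → phiW F w g ≡ phiW F w h → g ≡ h)
      × ((η : Subset n) → η ∈[ map (phiW F w) F ][ S ] →
          Σ (Subset n) (λ g → g ∈[ F ][ S ] × phiW F w g ≡ η)))
    × ((η : Subset n) → η ∈ map (phiW F w) F →
        (unionBelow F η ∈ F × phiW F w (unionBelow F η) ≡ η)
        × ((f : Subset n) → f ∈ F → phiW F w f ≡ η → f ≡ unionBelow F η))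
corollary3p5 n F w _ closed _ = restriction , inverse
  where
  rs : List (Fin n)
  rs = reverse w
  φ : Subset n → Subset n
  φ = phiRev F rs

  restriction : (S : Family n) → All (_∈ F) S →
    ((g : Subset n) → g ∈[ F ][ S ] → φ g ∈[ map φ F ][ S ])
    × ((g h : Subset n) → g ∈[ F ][ S ] → h ∈[ F ][ S ] → φ g ≡ φ h → g ≡ h)
    × ((η : Subset n) → η ∈[ map φ F ][ S ] → Σ (Subset n) (λ g → g ∈[ F ][ S ] × φ g ≡ η))
  restriction S S⊆F = into , (λ g h (g∈F , _) (h∈F , _) → phi-injective F closed rs g∈F h∈F) , onto
    where
    into : (g : Subset n) → g ∈[ F ][ S ] → φ g ∈[ map φ F ][ S ]
    into g (g∈F , z , z∈S , z⊆g) = ∈-map⁺ φ g∈F , z , z∈S , ⊆-trans z⊆g (phi-extensive F rs g)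
    onto : (η : Subset n) → η ∈[ map φ F ][ S ] → Σ (Subset n) (λ g → g ∈[ F ][ S ] × φ g ≡ η)
    onto η (η∈U , z , z∈S , z⊆η) with ∈-map⁻ φ η∈U
    ... | f , f∈F , refl = f , (f∈F , z , z∈S , no-capture F closed rs f∈F (lookup S⊆F z∈S) z⊆η) , refl

  inverse : (η : Subset n) → η ∈ map φ F →
    (unionBelow F η ∈ F × φ (unionBelow F η) ≡ η) × ((f : Subset n) → f ∈ F → φ f ≡ η → f ≡ unionBelow F η)
  inverse η η∈U with ∈-map⁻ φ η∈U
  ... | f , f∈F , refl =
    (subst (_∈ F) (sym f-recovered) f∈F , cong φ f-recovered)
    , λ f′ f′∈F φf′≡φf → trans (phi-injective F closed rs f′∈F f∈F φf′≡φf) (sym f-recovered)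
    where
    f-recovered : unionBelow F (φ f) ≡ f
    f-recovered = unionBelow-inverse F closed rs f∈F
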